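{- For every integer $\ell\geq1$, $$\sum_{\deg(f)=\ell}\phi(f)D_1(f)\leq(q-1)q^{3\ell},$$ where the sum runs over all $f\in\mathbb{F}_q[x]$ of degree $\ell$.
   Context: $q$ is a prime power, $\mathcal{R}=\mathbb{F}_q[x]$, and $|f|=q^{\deg f}$ for $f\in\mathcal{R}$. For $f\in\mathcal{R}$, $\phi(f)=\#\{g\in\mathcal{R}\setminus\{0\}:\deg g<\deg f,\ \gcd(f,g)=1\}$ and $D_1(f)=\sum_{g\mid f}|g|$, the sum over all monic divisors $g$ of $f$. -}

module Defs where

open import Level using (Level; _⊔_) renaming (suc to lsuc)
open import Algebra.Bundles using (CommutativeRing)
open import Data.Bool using (Bool; true; false; not; _∧_; _∨_; if_then_else_)
open import Data.Nat as ℕ using (ℕ; zero; suc; _^_)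
open import Data.List using (List; []; _∷_; [_]; _++_; map; concatMap; length; upTo)
open import Data.Nat.ListAction using (sum)
open import Data.Bool.ListAction using (any; all)
open import Data.List.Relation.Unary.Any using (Any)
open import Data.List.Relation.Unary.AllPairs using (AllPairs)
open import Data.Product using (∃)
open import Relation.Nullary using (¬_; does)
open import Relation.Binary using (Decidable)

record FiniteField (c ℓ : Level) : Set (lsuc (c ⊔ ℓ)) where
  field
    cring : CommutativeRing c ℓ
  open CommutativeRing cring public
  field
    _≟_      : Decidable _≈_
    0≉1      : ¬ (0# ≈ 1#)
    inverse  : ∀ x → ¬ (x ≈ 0#) → ∃ λ y → x * y ≈ 1#
    elems    : List Carrier
    complete : ∀ x → Any (x ≈_) elems
    distinct : AllPairs (λ x y → ¬ (x ≈ y)) elems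

module Poly {c ℓ} (F : FiniteField c ℓ) where
  open FiniteField F

  q : ℕ
  q = length elems

  -- polynomials in F[x] as coefficient lists, lowest degree first
  -- (trailing zero coefficients allowed; equality is up to them)
  P : Set c
  P = List Carrier

  isZeroC : Carrier → Bool
  isZeroC a = does (a ≟ 0#)

  addP : P → P → P
  addP [] g = g
  addP f [] = f
  addP (a ∷ f) (b ∷ g) = (a + b) ∷ addP f g

  negP : P → P
  negP = map (-_)

  mulP : P → P → P
  mulP [] g = []
  mulP (a ∷ f) g = addP (map (a *_) g) (0# ∷ mulP f g)

  isZeroP : P → Bool
  isZeroP = all isZeroC

  eqP : P → P → Bool
  eqP f g = isZeroP (addP f (negP g))

  allVecs : ℕ → List P
  allVecs zero = [ [] ]
  allVecs (suc n) = concatMap (λ a → map (a ∷_) (allVecs n)) elems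

  polysDeg : ℕ → List P
  polysDeg n = concatMap (λ a → if isZeroC a then [] else map (_++ [ a ]) (allVecs n)) elems

  monicDeg : ℕ → List P
  monicDeg n = map (_++ [ 1# ]) (allVecs n)

  -- g ∣ f : ∃ h, g * h = f.  A cofactor can be taken of degree ≤ deg f,
  -- so searching coefficient lists of length (length f) is exhaustive.
  divides : P → P → Bool
  divides g f = any (λ h → eqP (mulP g h) f) (allVecs (length f))

  -- for f of degree n (f ≠ 0): gcd(f,g) = 1 iff f and g have no common
  -- divisor of positive degree (necessarily of degree ≤ n)
  coprime : ℕ → P → P → Bool
  coprime n f g =
    not (any (λ d → any (λ h → divides h f ∧ divides h g) (polysDeg (suc d))) (upTo n))

  phi : ℕ → P → ℕ
  phi n f = sum (map (λ g → if not (isZeroP g) ∧ coprime n f g then 1 else 0) (allVecs n))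

  D1 : ℕ → P → ℕ
  D1 n f = sum (map (λ d → sum (map (λ g → if divides g f then q ^ d else 0) (monicDeg d))) (upTo (suc n)))

  sumPhiD1 : ℕ → ℕ
  sumPhiD1 n = sum (map (λ f → phi n f ℕ.* D1 n f) (polysDeg n))

{-# OPTIONS --safe #-}
module Submission where

-- For f of degree n, φ(f)·D₁(f) counts the tuples (h, g, r) with h a unit modulo f,
-- g a monic divisor of f and r ∈ F_q^(deg g).  Dividing h by g, h = w g + u, the map
-- (h, g, r) ↦ (u·(f/g), r ++ w) is an injection into pairs of polynomials of degree < n:
-- if u·(f/g) = u′·(f/g′), multiplying by g g′ and cancelling f gives u g′ = u′ g, and
-- since u is coprime to g (Bézout) g and g′ divide each other, so g = g′ and the rest
-- is recovered.  Hence φ(f)D₁(f) ≤ q^(2n), and there are (q − 1)q^n polynomials of degree n.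

open import Defs
open import Level using (Level; _⊔_)
open import Algebra.Bundles using (CommutativeRing; AbelianGroup)
open import Algebra.Structures using (IsAbelianGroup)
import Algebra.Consequences.Setoid as Consequences
import Algebra.Properties.CommutativeSemigroup as CommutativeSemigroupProperties
import Algebra.Properties.Ring as RingProperties
import Algebra.Properties.Semiring.Divisibility as SemiringDivisibility
import Algebra.Solver.Ring.NaturalCoefficients.Default as NaturalCoefficientsSolver
open import Data.Bool using (Bool; true; false; T; not; _∧_; if_then_else_)
open import Data.Bool.Properties using (T-∧)
open import Data.Empty using (⊥-elim)
open import Data.Fin using (Fin; zero; suc)
import Data.Fin.Properties as Fin
open import Data.List using (List; []; _∷_; [_]; map; length; _++_; lookup; concatMap; filterᵇ; upTo; cartesianProduct)
open import Data.List.Properties using (length-map; length-++; map-cong; ++-identityʳ)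
open import Data.List.Membership.Propositional using (_∈_)
open import Data.List.Membership.Propositional.Properties
  using (∈-lookup; ∈-++⁻; ∈-map⁻; ∈-concatMap⁻; ∈-filter⁻; ∈-cartesianProduct⁻)
import Data.List.Membership.Setoid as SetoidMembership
import Data.List.Membership.Setoid.Properties as SetoidMembershipₚ
open import Data.List.Relation.Binary.Disjoint.Setoid using (Disjoint)
open import Data.List.Relation.Unary.All as All using (All)
import Data.List.Relation.Unary.All.Properties as Allₚ
open import Data.List.Relation.Unary.AllPairs as AllPairs using ([]; _∷_)
import Data.List.Relation.Unary.AllPairs.Properties as AllPairsₚ
open import Data.List.Relation.Unary.Any as Any using (Any; here; there; index)
import Data.List.Relation.Unary.Any.Properties as Anyₚ
open import Data.List.Relation.Unary.Unique.Setoid using (Unique)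
import Data.List.Relation.Unary.Unique.Setoid.Properties as Uniqueₚ
import Data.List.Relation.Unary.Unique.Propositional.Properties as Unique≡ₚ
open import Data.Nat as ℕ using (ℕ; zero; suc; _≤_; _<_; z≤n; s≤s; _∸_; _^_)
import Data.Nat.Properties as ℕₚ
open ℕₚ using (≤-refl; ≤-trans; ≤-reflexive; ≤-antisym; ≰⇒>; n≤0⇒n≡0; +-mono-≤)
open import Data.Nat.ListAction using (sum)
open import Data.Product using (_×_; _,_; ∃; ∃₂; proj₁; proj₂)
import Data.Product as Product
open import Data.Product.Relation.Binary.Pointwise.NonDependent using (_×ₛ_)
open import Data.Sum using (inj₁; inj₂)
open import Data.Unit using (tt)
open import Function using (_∘_; Equivalence)
open import Relation.Binary using (IsEquivalence; Setoid)
open import Relation.Binary.PropositionalEquality as ≡ using (_≡_)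
import Relation.Binary.Reasoning.Setoid as SetoidReasoning
open import Relation.Nullary using (¬_; yes; no; Dec; contradiction)
open import Relation.Nullary.Decidable using (T?)

private
  variable
    a b ℓ₁ ℓ₂ : Level
    A : Set a
    B : Set b

-- Lists and counting

^-triple : ∀ m n → m ^ (3 ℕ.* n) ≡ m ^ n ℕ.* (m ^ n ℕ.* m ^ n)
^-triple m n = ≡.trans (ℕₚ.^-distribˡ-+-* m n (n ℕ.+ (n ℕ.+ 0))) (≡.cong (m ^ n ℕ.*_)
  (≡.trans (ℕₚ.^-distribˡ-+-* m n (n ℕ.+ 0)) (≡.cong (λ k → m ^ n ℕ.* m ^ k) (ℕₚ.+-identityʳ n))))

T-not⇒¬T : ∀ {b} → T (not b) → ¬ T b
T-not⇒¬T {false} _ ()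

if-0-≤ : ∀ b k → (if b then 0 else k) ≤ k
if-0-≤ true  k = z≤n
if-0-≤ false k = ≤-refl

length-concatMap : ∀ (f : A → List B) xs → length (concatMap f xs) ≡ sum (map (length ∘ f) xs)
length-concatMap f []       = ≡.refl
length-concatMap f (x ∷ xs) = ≡.trans (length-++ (f x)) (≡.cong (length (f x) ℕ.+_) (length-concatMap f xs))

length-cartesianProduct : ∀ (xs : List A) (ys : List B) →
                          length (cartesianProduct xs ys) ≡ length xs ℕ.* length ys
length-cartesianProduct []       ys = ≡.refl
length-cartesianProduct (x ∷ xs) ys =
  ≡.trans (length-++ (map (x ,_) ys)) (≡.cong₂ ℕ._+_ (length-map (x ,_) ys) (length-cartesianProduct xs ys))

sum-map-const : ∀ k (xs : List A) → sum (map (λ _ → k) xs) ≡ length xs ℕ.* k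
sum-map-const k []       = ≡.refl
sum-map-const k (x ∷ xs) = ≡.cong (k ℕ.+_) (sum-map-const k xs)

sum-map-mono : ∀ {f g : A → ℕ} xs → (∀ {x} → x ∈ xs → f x ≤ g x) → sum (map f xs) ≤ sum (map g xs)
sum-map-mono []       f≤g = z≤n
sum-map-mono (x ∷ xs) f≤g = +-mono-≤ (f≤g (here ≡.refl)) (sum-map-mono xs (f≤g ∘ there))

sum-map-if-≤ : ∀ (p : A → Bool) k xs → Any (T ∘ p) xs →
               sum (map (λ x → if p x then 0 else k) xs) ≤ (length xs ∸ 1) ℕ.* k
sum-map-if-≤ p k (x ∷ xs) (here px) with p x
... | true =
  ≤-trans (sum-map-mono xs (λ {y} _ → if-0-≤ (p y) k)) (≤-reflexive (sum-map-const k xs))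
sum-map-if-≤ p k (x ∷ y ∷ xs) (there p∈) = +-mono-≤ (if-0-≤ (p x) k) (sum-map-if-≤ p k (y ∷ xs) p∈)

length-filterᵇ : ∀ (p : A → Bool) xs → length (filterᵇ p xs) ≡ sum (map (λ x → if p x then 1 else 0) xs)
length-filterᵇ p []       = ≡.refl
length-filterᵇ p (x ∷ xs) with p x
... | true  = ≡.cong suc (length-filterᵇ p xs)
... | false = length-filterᵇ p xs

dependentProduct : List A → (A → List B) → List (A × B)
dependentProduct xs ys = concatMap (λ x → map (x ,_) (ys x)) xs

length-dependentProduct : ∀ xs (ys : A → List B) →
                          length (dependentProduct xs ys) ≡ sum (map (length ∘ ys) xs)
length-dependentProduct xs ys =
  ≡.trans (length-concatMap (λ x → map (x ,_) (ys x)) xs) (≡.cong sum (map-cong (λ x → length-map (x ,_) (ys x)) xs))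

∈-dependentProduct⁻ : ∀ xs (ys : A → List B) {x y} →
                      (x , y) ∈ dependentProduct xs ys → x ∈ xs × y ∈ ys x
∈-dependentProduct⁻ (x ∷ xs) ys p with ∈-++⁻ (map (x ,_) (ys x)) p
... | inj₁ p′ with _ , y∈ , ≡.refl ← ∈-map⁻ (x ,_) p′ = here ≡.refl , y∈
... | inj₂ p′ = Product.map₁ there (∈-dependentProduct⁻ xs ys p′)

module _ (S : Setoid a ℓ₁) where
  open Setoid S using (_≈_; sym)

  Unique-lookup-injective : ∀ {xs} → Unique S xs → ∀ i j → lookup xs i ≈ lookup xs j → i ≡ j
  Unique-lookup-injective (_ ∷ _)   zero    zero    _  = ≡.refl
  Unique-lookup-injective (x≉ ∷ _)  zero    (suc j) x≈ = contradiction x≈ (All.lookup x≉ (∈-lookup j))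
  Unique-lookup-injective (x≉ ∷ _)  (suc i) zero    x≈ = contradiction (sym x≈) (All.lookup x≉ (∈-lookup i))
  Unique-lookup-injective (_ ∷ xs!) (suc i) (suc j) x≈ = ≡.cong suc (Unique-lookup-injective xs! i j x≈)

module _ (S₁ : Setoid a ℓ₁) (S₂ : Setoid b ℓ₂) where
  open Setoid S₁ using () renaming (Carrier to C; _≈_ to _≈₁_; sym to sym₁; trans to trans₁)
  open Setoid S₂ using () renaming (Carrier to D; _≈_ to _≈₂_)
  open SetoidMembership S₁ using () renaming (_∈_ to _∈₁_)
  open SetoidMembership S₂ using () renaming (_∈_ to _∈₂_)
  open SetoidMembership (S₁ ×ₛ S₂) using () renaming (_∈_ to _∈₁₂_)

  proj₁-∈-dependentProduct : ∀ xs (ys : C → List D) {v} → v ∈₁₂ dependentProduct xs ys → proj₁ v ∈₁ xs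
  proj₁-∈-dependentProduct (x ∷ xs) ys p with SetoidMembershipₚ.∈-++⁻ (S₁ ×ₛ S₂) (map (x ,_) (ys x)) p
  ... | inj₁ p′ = here (proj₁ (proj₂ (proj₂ (SetoidMembershipₚ.∈-map⁻ S₂ (S₁ ×ₛ S₂) p′))))
  ... | inj₂ p′ = there (proj₁-∈-dependentProduct xs ys p′)

  dependentProduct⁺ : ∀ {xs} {ys : C → List D} → Unique S₁ xs → (∀ x → Unique S₂ (ys x)) →
                      Unique (S₁ ×ₛ S₂) (dependentProduct xs ys)
  dependentProduct⁺ {[]}     []            ys! = []
  dependentProduct⁺ {x ∷ xs} {ys} (x∉xs ∷ xs!) ys! =
    Uniqueₚ.++⁺ (S₁ ×ₛ S₂) (Uniqueₚ.map⁺ S₂ (S₁ ×ₛ S₂) proj₂ (ys! x)) (dependentProduct⁺ xs! ys!) disjoint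
    where
    disjoint : Disjoint (S₁ ×ₛ S₂) (map (x ,_) (ys x)) (dependentProduct xs ys)
    disjoint (v∈x , v∈xs) =
      let _ , _ , v≈x = SetoidMembershipₚ.∈-map⁻ S₂ (S₁ ×ₛ S₂) v∈x
      in Allₚ.All¬⇒¬Any x∉xs (Any.map (trans₁ (sym₁ (proj₁ v≈x))) (proj₁-∈-dependentProduct xs ys v∈xs))

  injective⇒length≤ : ∀ {xs ys} (f : C → D) → Unique S₁ xs →
                      (∀ {x y} → x ∈ xs → y ∈ xs → f x ≈₂ f y → x ≈₁ y) →
                      (∀ {x} → x ∈ xs → f x ∈₂ ys) →
                      length xs ≤ length ys
  injective⇒length≤ {xs} {ys} f xs! f-inj f∈ys = Fin.injective⇒≤ position-injective
    where
    position : Fin (length xs) → Fin (length ys)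
    position i = index (f∈ys (∈-lookup i))

    position-injective : ∀ {i j} → position i ≡ position j → i ≡ j
    position-injective {i} {j} eq = Unique-lookup-injective S₁ xs! i j
      (f-inj (∈-lookup i) (∈-lookup j)
        (SetoidMembershipₚ.index-injective S₂ (f∈ys (∈-lookup i)) (f∈ys (∈-lookup j)) eq))

module _ {c ℓ} (F : FiniteField c ℓ) where
  open FiniteField F hiding (zero)
  open Poly F
  open RingProperties ring using (-0#≈0#)

  -- The polynomial ring

  coeff : P → ℕ → Carrier
  coeff []      _       = 0#
  coeff (a ∷ f) zero    = a
  coeff (a ∷ f) (suc i) = coeff f i

  infix 4 _≋_
  record _≋_ (f g : P) : Set ℓ where
    constructor mk≋
    field coeff≈ : ∀ i → coeff f i ≈ coeff g i
  open _≋_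

  ≋-isEquivalence : IsEquivalence _≋_
  ≋-isEquivalence = record
    { refl  = mk≋ λ _ → refl
    ; sym   = λ f≋g → mk≋ λ i → sym (coeff≈ f≋g i)
    ; trans = λ f≋g g≋h → mk≋ λ i → trans (coeff≈ f≋g i) (coeff≈ g≋h i)
    }

  open IsEquivalence ≋-isEquivalence
    using () renaming (refl to ≋-refl; sym to ≋-sym; trans to ≋-trans; reflexive to ≋-reflexive)

  ≋-setoid : Setoid c ℓ
  ≋-setoid = record { isEquivalence = ≋-isEquivalence }

  ∷-cong : ∀ {a b f g} → a ≈ b → f ≋ g → a ∷ f ≋ b ∷ g
  ∷-cong a≈b f≋g = mk≋ λ { zero → a≈b ; (suc i) → coeff≈ f≋g i }

  ∷-injectiveˡ : ∀ {a b f g} → a ∷ f ≋ b ∷ g → a ≈ b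
  ∷-injectiveˡ e = coeff≈ e zero

  ∷-injectiveʳ : ∀ {a b f g} → a ∷ f ≋ b ∷ g → f ≋ g
  ∷-injectiveʳ e = mk≋ λ i → coeff≈ e (suc i)

  coeff-addP : ∀ f g i → coeff (addP f g) i ≈ coeff f i + coeff g i
  coeff-addP []      g       i       = sym (+-identityˡ _)
  coeff-addP (a ∷ f) []      i       = sym (+-identityʳ _)
  coeff-addP (a ∷ f) (b ∷ g) zero    = refl
  coeff-addP (a ∷ f) (b ∷ g) (suc i) = coeff-addP f g i

  coeff-negP : ∀ f i → coeff (negP f) i ≈ - coeff f i
  coeff-negP []      i       = sym -0#≈0#
  coeff-negP (a ∷ f) zero    = refl
  coeff-negP (a ∷ f) (suc i) = coeff-negP f i

  ∷-≋[] : ∀ {a f} → a ≈ 0# → f ≋ [] → a ∷ f ≋ []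
  ∷-≋[] a≈0 f≋[] = mk≋ λ { zero → a≈0 ; (suc i) → coeff≈ f≋[] i }

  addP-cong : ∀ {f f′ g g′} → f ≋ f′ → g ≋ g′ → addP f g ≋ addP f′ g′
  addP-cong {f} {f′} {g} {g′} f≋f′ g≋g′ = mk≋ λ i → begin
    coeff (addP f g) i       ≈⟨ coeff-addP f g i ⟩
    coeff f i + coeff g i    ≈⟨ +-cong (coeff≈ f≋f′ i) (coeff≈ g≋g′ i) ⟩
    coeff f′ i + coeff g′ i  ≈⟨ coeff-addP f′ g′ i ⟨
    coeff (addP f′ g′) i     ∎
    where open SetoidReasoning setoid

  addP-congˡ : ∀ f {g g′} → g ≋ g′ → addP f g ≋ addP f g′
  addP-congˡ f = addP-cong (≋-refl {f})

  addP-congʳ : ∀ {f f′} g → f ≋ f′ → addP f g ≋ addP f′ g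
  addP-congʳ g f≋f′ = addP-cong f≋f′ (≋-refl {g})

  addP-assoc : ∀ f g h → addP (addP f g) h ≋ addP f (addP g h)
  addP-assoc f g h = mk≋ λ i → begin
    coeff (addP (addP f g) h) i          ≈⟨ trans (coeff-addP (addP f g) h i) (+-congʳ (coeff-addP f g i)) ⟩
    (coeff f i + coeff g i) + coeff h i  ≈⟨ +-assoc _ _ _ ⟩
    coeff f i + (coeff g i + coeff h i)  ≈⟨ trans (coeff-addP f (addP g h) i) (+-congˡ (coeff-addP g h i)) ⟨
    coeff (addP f (addP g h)) i          ∎
    where open SetoidReasoning setoid

  addP-comm : ∀ f g → addP f g ≋ addP g f
  addP-comm f g = mk≋ λ i → trans (coeff-addP f g i) (trans (+-comm _ _) (sym (coeff-addP g f i)))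

  addP-identityʳ : ∀ f → addP f [] ≋ f
  addP-identityʳ []      = ≋-refl
  addP-identityʳ (a ∷ f) = ≋-refl

  negP-cong : ∀ {f g} → f ≋ g → negP f ≋ negP g
  negP-cong {f} {g} f≋g = mk≋ λ i →
    trans (coeff-negP f i) (trans (-‿cong (coeff≈ f≋g i)) (sym (coeff-negP g i)))

  addP-inverseˡ : ∀ f → addP (negP f) f ≋ []
  addP-inverseˡ f = mk≋ λ i →
    trans (coeff-addP (negP f) f i) (trans (+-congʳ (coeff-negP f i)) (-‿inverseˡ _))

  addP-inverseʳ : ∀ f → addP f (negP f) ≋ []
  addP-inverseʳ f = mk≋ λ i →
    trans (coeff-addP f (negP f) i) (trans (+-congˡ (coeff-negP f i)) (-‿inverseʳ _))

  addP-isAbelianGroup : IsAbelianGroup _≋_ addP [] negP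
  addP-isAbelianGroup = record
    { isGroup = record
      { isMonoid = record
        { isSemigroup = record
          { isMagma = record { isEquivalence = ≋-isEquivalence ; ∙-cong = addP-cong }
          ; assoc   = addP-assoc
          }
        ; identity = (λ _ → ≋-refl) , addP-identityʳ
        }
      ; inverse = addP-inverseˡ , addP-inverseʳ
      ; ⁻¹-cong = negP-cong
      }
    ; comm = addP-comm
    }

  addP-abelianGroup : AbelianGroup c ℓ
  addP-abelianGroup = record { isAbelianGroup = addP-isAbelianGroup }

  open CommutativeSemigroupProperties (AbelianGroup.commutativeSemigroup addP-abelianGroup)
    using () renaming (interchange to addP-interchange; x∙yz≈y∙xz to addP-leftComm)

  scale : Carrier → P → P
  scale a = map (a *_)

  coeff-scale : ∀ a g i → coeff (scale a g) i ≈ a * coeff g i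
  coeff-scale a []      i       = sym (zeroʳ a)
  coeff-scale a (b ∷ g) zero    = refl
  coeff-scale a (b ∷ g) (suc i) = coeff-scale a g i

  scale-cong : ∀ {a b f g} → a ≈ b → f ≋ g → scale a f ≋ scale b g
  scale-cong {a} {b} {f} {g} a≈b f≋g = mk≋ λ i →
    trans (coeff-scale a f i) (trans (*-cong a≈b (coeff≈ f≋g i)) (sym (coeff-scale b g i)))

  scale-addP : ∀ a f g → scale a (addP f g) ≋ addP (scale a f) (scale a g)
  scale-addP a f g = mk≋ λ i → begin
    coeff (scale a (addP f g)) i           ≈⟨ trans (coeff-scale a (addP f g) i) (*-congˡ (coeff-addP f g i)) ⟩
    a * (coeff f i + coeff g i)            ≈⟨ distribˡ a _ _ ⟩
    a * coeff f i + a * coeff g i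
      ≈⟨ trans (coeff-addP (scale a f) (scale a g) i) (+-cong (coeff-scale a f i) (coeff-scale a g i)) ⟨
    coeff (addP (scale a f) (scale a g)) i ∎
    where open SetoidReasoning setoid

  scale-scale : ∀ a b f → scale a (scale b f) ≋ scale (a * b) f
  scale-scale a b f = mk≋ λ i → begin
    coeff (scale a (scale b f)) i  ≈⟨ trans (coeff-scale a (scale b f) i) (*-congˡ (coeff-scale b f i)) ⟩
    a * (b * coeff f i)            ≈⟨ *-assoc a b _ ⟨
    a * b * coeff f i              ≈⟨ coeff-scale (a * b) f i ⟨
    coeff (scale (a * b) f) i      ∎
    where open SetoidReasoning setoid

  scale-identity : ∀ f → scale 1# f ≋ f
  scale-identity f = mk≋ λ i → trans (coeff-scale 1# f i) (*-identityˡ _)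

  scale-zero : ∀ f → scale 0# f ≋ []
  scale-zero f = mk≋ λ i → trans (coeff-scale 0# f i) (zeroˡ _)

  0∷-addP : ∀ f g → 0# ∷ addP f g ≋ addP (0# ∷ f) (0# ∷ g)
  0∷-addP f g = ∷-cong (sym (+-identityˡ 0#)) ≋-refl

  mulP-zeroʳ : ∀ f → mulP f [] ≋ []
  mulP-zeroʳ []      = ≋-refl
  mulP-zeroʳ (a ∷ f) = ∷-≋[] refl (mulP-zeroʳ f)

  mulP-congʳ : ∀ f {g g′} → g ≋ g′ → mulP f g ≋ mulP f g′
  mulP-congʳ []      g≋g′ = ≋-refl
  mulP-congʳ (a ∷ f) g≋g′ = addP-cong (scale-cong refl g≋g′) (∷-cong refl (mulP-congʳ f g≋g′))

  mulP-consʳ : ∀ f b g → mulP f (b ∷ g) ≋ addP (scale b f) (0# ∷ mulP f g)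
  mulP-consʳ []      b g = ≋-sym (∷-≋[] refl (≋-refl {[]}))
  mulP-consʳ (a ∷ f) b g = ∷-cong (+-congʳ (*-comm a b)) (≋-trans
    (addP-congˡ (scale a g) (mulP-consʳ f b g)) (addP-leftComm (scale a g) (scale b f) (0# ∷ mulP f g)))

  mulP-comm : ∀ f g → mulP f g ≋ mulP g f
  mulP-comm []      g = ≋-sym (mulP-zeroʳ g)
  mulP-comm (a ∷ f) g =
    ≋-trans (addP-congˡ (scale a g) (∷-cong refl (mulP-comm f g))) (≋-sym (mulP-consʳ g a f))

  mulP-congˡ : ∀ {f f′} g → f ≋ f′ → mulP f g ≋ mulP f′ g
  mulP-congˡ {f} {f′} g f≋f′ = ≋-trans (mulP-comm f g) (≋-trans (mulP-congʳ g f≋f′) (mulP-comm g f′))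

  mulP-distribˡ : ∀ f g g′ → mulP f (addP g g′) ≋ addP (mulP f g) (mulP f g′)
  mulP-distribˡ []      g g′ = ≋-refl
  mulP-distribˡ (a ∷ f) g g′ = begin
    addP (scale a (addP g g′)) (0# ∷ mulP f (addP g g′))
      ≈⟨ addP-cong (scale-addP a g g′) (∷-cong refl (mulP-distribˡ f g g′)) ⟩
    addP (addP (scale a g) (scale a g′)) (0# ∷ addP (mulP f g) (mulP f g′))
      ≈⟨ addP-congˡ (addP (scale a g) (scale a g′)) (0∷-addP (mulP f g) (mulP f g′)) ⟩
    addP (addP (scale a g) (scale a g′)) (addP (0# ∷ mulP f g) (0# ∷ mulP f g′))
      ≈⟨ addP-interchange (scale a g) (scale a g′) (0# ∷ mulP f g) (0# ∷ mulP f g′) ⟩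
    addP (mulP (a ∷ f) g) (mulP (a ∷ f) g′) ∎
    where open SetoidReasoning ≋-setoid

  mulP-distribʳ : ∀ h f g → mulP (addP f g) h ≋ addP (mulP f h) (mulP g h)
  mulP-distribʳ = Consequences.comm∧distrˡ⇒distrʳ ≋-setoid addP-cong mulP-comm mulP-distribˡ

  scale-mulP : ∀ a f g → mulP (scale a f) g ≋ scale a (mulP f g)
  scale-mulP a []      g = ≋-refl
  scale-mulP a (b ∷ f) g = begin
    addP (scale (a * b) g) (0# ∷ mulP (scale a f) g)
      ≈⟨ addP-cong (≋-sym (scale-scale a b g)) (∷-cong (sym (zeroʳ a)) (scale-mulP a f g)) ⟩
    addP (scale a (scale b g)) (scale a (0# ∷ mulP f g))
      ≈⟨ scale-addP a (scale b g) (0# ∷ mulP f g) ⟨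
    scale a (mulP (b ∷ f) g) ∎
    where open SetoidReasoning ≋-setoid

  mulP-assoc : ∀ f g h → mulP (mulP f g) h ≋ mulP f (mulP g h)
  mulP-assoc []      g h = ≋-refl
  mulP-assoc (a ∷ f) g h = begin
    mulP (addP (scale a g) (0# ∷ mulP f g)) h
      ≈⟨ mulP-distribʳ h (scale a g) (0# ∷ mulP f g) ⟩
    addP (mulP (scale a g) h) (addP (scale 0# h) (0# ∷ mulP (mulP f g) h))
      ≈⟨ addP-cong (scale-mulP a g h) (addP-congʳ (0# ∷ mulP (mulP f g) h) (scale-zero h)) ⟩
    addP (scale a (mulP g h)) (0# ∷ mulP (mulP f g) h)
      ≈⟨ addP-congˡ (scale a (mulP g h)) (∷-cong refl (mulP-assoc f g h)) ⟩
    mulP (a ∷ f) (mulP g h) ∎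
    where open SetoidReasoning ≋-setoid

  mulP-singleton : ∀ t g → mulP (t ∷ []) g ≋ scale t g
  mulP-singleton t g = ≋-trans (addP-congˡ (scale t g) (∷-≋[] refl (≋-refl {[]}))) (addP-identityʳ (scale t g))

  mulP-0∷ : ∀ w g → mulP (0# ∷ w) g ≋ 0# ∷ mulP w g
  mulP-0∷ w g = addP-congʳ (0# ∷ mulP w g) (scale-zero g)

  mulP-identityˡ : ∀ f → mulP (1# ∷ []) f ≋ f
  mulP-identityˡ f = ≋-trans (mulP-singleton 1# f) (scale-identity f)

  polyRing : CommutativeRing c ℓ
  polyRing = record
    { Carrier = P ; _≈_ = _≋_ ; _+_ = addP ; _*_ = mulP ; -_ = negP ; 0# = [] ; 1# = 1# ∷ []
    ; isCommutativeRing = record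
      { isRing = record
        { +-isAbelianGroup = addP-isAbelianGroup
        ; *-cong           = λ {f} {f′} {g} {g′} f≋f′ g≋g′ →
                               ≋-trans (mulP-congˡ g f≋f′) (mulP-congʳ f′ g≋g′)
        ; *-assoc          = mulP-assoc
        ; *-identity       = Consequences.comm∧idˡ⇒id ≋-setoid mulP-comm mulP-identityˡ
        ; distrib          = mulP-distribˡ , mulP-distribʳ
        }
      ; *-comm = mulP-comm
      }
    }

  -- Degree

  -- len f is deg f + 1 for f ≉ 0, and 0 for f ≋ 0.
  lenCons : Carrier → ℕ → ℕ
  lenCons a zero    = if isZeroC a then 0 else 1
  lenCons a (suc m) = suc (suc m)

  len : P → ℕ
  len []      = 0
  len (a ∷ f) = lenCons a (len f)

  len-∷-≤ : ∀ a f → len (a ∷ f) ≤ suc (len f)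
  len-∷-≤ a f with len f
  ... | suc m = ≤-refl
  ... | zero with a ≟ 0#
  ...   | yes _ = z≤n
  ...   | no  _ = ≤-refl

  len-tail-≤ : ∀ a f {k} → len (a ∷ f) ≤ suc k → len f ≤ k
  len-tail-≤ a f le with len f
  ... | zero  = z≤n
  ... | suc m = ℕₚ.≤-pred le

  coeff-≥len : ∀ f {i} → len f ≤ i → coeff f i ≈ 0#
  coeff-≥len []      _  = refl
  coeff-≥len (a ∷ f) {suc i} le = coeff-≥len f (len-tail-≤ a f le)
  coeff-≥len (a ∷ f) {zero}  le with len f
  ... | zero with a ≟ 0#
  ...   | yes a≈0 = a≈0
  coeff-≥len (a ∷ f) {zero} () | zero | no _

  coeff-lead : ∀ f {m} → len f ≡ suc m → ¬ coeff f m ≈ 0#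
  coeff-lead (a ∷ f) {m} eq with len f in eq′
  coeff-lead (a ∷ f) {.(suc k)} ≡.refl | suc k = coeff-lead f eq′
  coeff-lead (a ∷ f) {m}        eq     | zero with a ≟ 0#
  coeff-lead (a ∷ f) {zero}     ≡.refl | zero | no a≉0 = a≉0

  vanishes⇒len≤ : ∀ f {k} → (∀ i → k ≤ i → coeff f i ≈ 0#) → len f ≤ k
  vanishes⇒len≤ []      vanish = z≤n
  vanishes⇒len≤ (a ∷ f) {suc k} vanish =
    ≤-trans (len-∷-≤ a f) (s≤s (vanishes⇒len≤ f λ i k≤i → vanish (suc i) (s≤s k≤i)))
  vanishes⇒len≤ (a ∷ f) {zero}  vanish with len f | vanishes⇒len≤ f {0} (λ i _ → vanish (suc i) z≤n)
  ... | zero | _ with a ≟ 0#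
  ...   | yes _   = z≤n
  ...   | no  a≉0 = ⊥-elim (a≉0 (vanish 0 z≤n))

  coeff≉0⇒<len : ∀ f {i} → ¬ coeff f i ≈ 0# → i < len f
  coeff≉0⇒<len f coeff≉0 = ≰⇒> λ len≤i → coeff≉0 (coeff-≥len f len≤i)

  len-cong : ∀ {f g} → f ≋ g → len f ≡ len g
  len-cong {f} {g} f≋g = ≤-antisym
    (vanishes⇒len≤ f λ i le → trans (coeff≈ f≋g i) (coeff-≥len g le))
    (vanishes⇒len≤ g λ i le → trans (sym (coeff≈ f≋g i)) (coeff-≥len f le))

  len≡0⇒≋[] : ∀ f → len f ≡ 0 → f ≋ []
  len≡0⇒≋[] f eq = mk≋ λ i → coeff-≥len f (≤-trans (≤-reflexive eq) z≤n)

  ≋[]? : ∀ f → Dec (f ≋ [])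
  ≋[]? f with len f ℕ.≟ 0
  ... | yes eq  = yes (len≡0⇒≋[] f eq)
  ... | no  neq = no λ f≋[] → neq (len-cong f≋[])

  len≡suc⇒≉[] : ∀ {f m} → len f ≡ suc m → ¬ f ≋ []
  len≡suc⇒≉[] lf f≈0 = ℕₚ.1+n≢0 (≡.trans (≡.sym lf) (len-cong f≈0))

  ≉[]⇒len≡suc : ∀ {f} → ¬ f ≋ [] → ∃ λ m → len f ≡ suc m
  ≉[]⇒len≡suc {f} f≉[] with len f in eq
  ... | zero  = ⊥-elim (f≉[] (len≡0⇒≋[] f eq))
  ... | suc m = m , ≡.refl

  len-addP-≤ : ∀ f g {k} → len f ≤ k → len g ≤ k → len (addP f g) ≤ k
  len-addP-≤ f g lf lg = vanishes⇒len≤ (addP f g) λ i k≤i → trans (coeff-addP f g i)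
    (trans (+-cong (coeff-≥len f (≤-trans lf k≤i)) (coeff-≥len g (≤-trans lg k≤i))) (+-identityˡ 0#))

  len-scale-≤ : ∀ a g → len (scale a g) ≤ len g
  len-scale-≤ a g = vanishes⇒len≤ (scale a g) λ i le →
    trans (coeff-scale a g i) (trans (*-congˡ (coeff-≥len g le)) (zeroʳ a))

  len-mulP-≤ : ∀ f g {a b} → len f ≤ a → len g ≤ suc b → len (mulP f g) ≤ a ℕ.+ b
  len-mulP-≤ f       g {zero}   lf lg =
    ≤-trans (≤-reflexive (len-cong (mulP-congˡ g (len≡0⇒≋[] f (n≤0⇒n≡0 lf))))) z≤n
  len-mulP-≤ []      g {suc a}  lf lg = z≤n
  len-mulP-≤ (c ∷ f) g {suc a} {b} lf lg = len-addP-≤ (scale c g) (0# ∷ mulP f g)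
    (≤-trans (len-scale-≤ c g) (≤-trans lg (s≤s (ℕₚ.m≤n+m b a))))
    (≤-trans (len-∷-≤ 0# (mulP f g)) (s≤s (len-mulP-≤ f g (len-tail-≤ c f lf) lg)))

  coeff-mulP-top : ∀ f g {a b} → len f ≤ suc a → len g ≤ suc b →
                   coeff (mulP f g) (a ℕ.+ b) ≈ coeff f a * coeff g b
  coeff-mulP-top []      g         lf lg = sym (zeroˡ _)
  coeff-mulP-top (c ∷ f) g {zero} {b} lf lg = begin
    coeff (addP (scale c g) (0# ∷ mulP f g)) b      ≈⟨ coeff-addP (scale c g) _ b ⟩
    coeff (scale c g) b + coeff (0# ∷ mulP f g) b   ≈⟨ +-cong (coeff-scale c g b) (coeff≈ 0∷fg≋[] b) ⟩
    c * coeff g b + 0#                              ≈⟨ +-identityʳ _ ⟩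
    c * coeff g b                                   ∎
    where
    open SetoidReasoning setoid
    0∷fg≋[] : 0# ∷ mulP f g ≋ []
    0∷fg≋[] = ∷-≋[] refl (mulP-congˡ g (len≡0⇒≋[] f (n≤0⇒n≡0 (len-tail-≤ c f lf))))
  coeff-mulP-top (c ∷ f) g {suc a} {b} lf lg = begin
    coeff (addP (scale c g) (0# ∷ mulP f g)) (suc (a ℕ.+ b))        ≈⟨ coeff-addP (scale c g) _ (suc (a ℕ.+ b)) ⟩
    coeff (scale c g) (suc (a ℕ.+ b)) + coeff (mulP f g) (a ℕ.+ b)
      ≈⟨ +-cong scale-vanishes (coeff-mulP-top f g (len-tail-≤ c f lf) lg) ⟩
    0# + coeff f a * coeff g b                                      ≈⟨ +-identityˡ _ ⟩
    coeff f a * coeff g b                                           ∎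
    where
    open SetoidReasoning setoid
    scale-vanishes : coeff (scale c g) (suc (a ℕ.+ b)) ≈ 0#
    scale-vanishes = coeff-≥len (scale c g) (≤-trans (len-scale-≤ c g) (≤-trans lg (s≤s (ℕₚ.m≤n+m b a))))

  -- Junk value: inv 0# = 0#.
  inv : Carrier → Carrier
  inv x with x ≟ 0#
  ... | yes _   = 0#
  ... | no  x≉0 = proj₁ (inverse x x≉0)

  *-inverseʳ : ∀ {x} → ¬ x ≈ 0# → x * inv x ≈ 1#
  *-inverseʳ {x} x≉0 with x ≟ 0#
  ... | yes x≈0 = ⊥-elim (x≉0 x≈0)
  ... | no  x≉0 = proj₂ (inverse x x≉0)

  x≉0∧y≉0⇒xy≉0 : ∀ {x y} → ¬ x ≈ 0# → ¬ y ≈ 0# → ¬ x * y ≈ 0#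
  x≉0∧y≉0⇒xy≉0 {x} {y} x≉0 y≉0 xy≈0 = y≉0 (begin
    y                ≈⟨ *-identityˡ y ⟨
    1# * y           ≈⟨ *-congʳ (trans (*-comm (inv x) x) (*-inverseʳ x≉0)) ⟨
    inv x * x * y    ≈⟨ *-assoc (inv x) x y ⟩
    inv x * (x * y)  ≈⟨ *-congˡ xy≈0 ⟩
    inv x * 0#       ≈⟨ zeroʳ (inv x) ⟩
    0#               ∎)
    where open SetoidReasoning setoid

  len-mulP : ∀ f g {a b} → len f ≡ suc a → len g ≡ suc b → len (mulP f g) ≡ suc (a ℕ.+ b)
  len-mulP f g {a} {b} lf lg = ≤-antisym
    (len-mulP-≤ f g (≤-reflexive lf) (≤-reflexive lg))
    (coeff≉0⇒<len (mulP f g) λ top≈0 → x≉0∧y≉0⇒xy≉0 (coeff-lead f lf) (coeff-lead g lg)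
      (trans (sym (coeff-mulP-top f g (≤-reflexive lf) (≤-reflexive lg))) top≈0))

  -- Division and divisibility

  module ℙ = CommutativeRing polyRing
  open RingProperties ℙ.ring
    using (x[y-z]≈xy-xz; [y-z]x≈yx-zx; x∙y⁻¹≈ε⇒x≈y; x≈y⇒x∙y⁻¹≈ε; xyx⁻¹≈y)
  open SemiringDivisibility ℙ.semiring
    using (_∣_; _,_; _∣0; ∣ʳ-reflexive; ∣ʳ-trans; x∣ʳyx; x∣ʳy⇒x∣ʳzy; ∣ʳ-respʳ-≈; ∣ʳ-respˡ-≈
          ; x∣y∧y≉0⇒x≉0)
  module ℙ-Solver = NaturalCoefficientsSolver ℙ.commutativeSemiring

  mulP-≉[] : ∀ {f g} → ¬ f ≋ [] → ¬ g ≋ [] → ¬ mulP f g ≋ []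
  mulP-≉[] {f} {g} f≉0 g≉0 fg≈0 with ≉[]⇒len≡suc f≉0 | ≉[]⇒len≡suc g≉0
  ... | a , lf | b , lg = ℕₚ.1+n≢0 (≡.trans (≡.sym (len-mulP f g lf lg)) (len-cong fg≈0))

  mulP-cancelˡ : ∀ {h f g} → ¬ h ≋ [] → mulP h f ≋ mulP h g → f ≋ g
  mulP-cancelˡ {h} {f} {g} h≉0 hf≈hg with ≋[]? (f ℙ.- g)
  ... | yes f-g≈0 = x∙y⁻¹≈ε⇒x≈y f g f-g≈0
  ... | no  f-g≉0 = ⊥-elim (mulP-≉[] h≉0 f-g≉0 (≋-trans (x[y-z]≈xy-xz h f g) (x≈y⇒x∙y⁻¹≈ε hf≈hg)))

  mulP-cancelʳ : ∀ {h f g} → ¬ h ≋ [] → mulP f h ≋ mulP g h → f ≋ g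
  mulP-cancelʳ {h} {f} {g} h≉0 fh≈gh = mulP-cancelˡ h≉0 (≋-trans (mulP-comm h f) (≋-trans fh≈gh (mulP-comm g h)))

  len≤len-mulPʳ : ∀ f g → ¬ f ≋ [] → len g ≤ len (mulP f g)
  len≤len-mulPʳ f g f≉0 with ≋[]? g
  ... | yes g≈0 = ≤-trans (≤-reflexive (len-cong g≈0)) z≤n
  ... | no  g≉0 with ≉[]⇒len≡suc f≉0 | ≉[]⇒len≡suc g≉0
  ...   | a , lf | b , lg =
    ≤-trans (≤-reflexive lg) (≤-trans (s≤s (ℕₚ.m≤n+m b a)) (≤-reflexive (≡.sym (len-mulP f g lf lg))))

  ∣⇒len≤ : ∀ {g f} → g ∣ f → ¬ f ≋ [] → len g ≤ len f
  ∣⇒len≤ {g} {f} (k , kg≈f) f≉0 = ≤-trans (len≤len-mulPʳ k g k≉0) (≤-reflexive (len-cong kg≈f))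
    where
    k≉0 : ¬ k ≋ []
    k≉0 = x∣y∧y≉0⇒x≉0 (g , ≋-trans (mulP-comm g k) kg≈f) f≉0

  leadRatio : P → P → Carrier
  leadRatio v g = coeff v (ℕ.pred (len g)) * inv (coeff g (ℕ.pred (len g)))

  leadRatio-cancels : ∀ v g {m} → len g ≡ suc m → leadRatio v g * coeff g m ≈ coeff v m
  leadRatio-cancels v g {m} lg = begin
    leadRatio v g * coeff g m
      ≡⟨ ≡.cong (λ k → coeff v k * inv (coeff g k) * coeff g m) (≡.cong ℕ.pred lg) ⟩
    coeff v m * inv (coeff g m) * coeff g m   ≈⟨ *-assoc _ _ _ ⟩
    coeff v m * (inv (coeff g m) * coeff g m) ≈⟨ *-congˡ (trans (*-comm _ _) (*-inverseʳ (coeff-lead g lg))) ⟩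
    coeff v m * 1#                            ≈⟨ *-identityʳ _ ⟩
    coeff v m                                 ∎
    where open SetoidReasoning setoid

  -- Long division, starting from the top coefficients of h: bring down the next
  -- coefficient c, then cancel the coefficient of x^(deg g) with a multiple of g.
  divMod : P → P → P × P
  divMod []      g = [] , []
  divMod (c ∷ h) g = addP (0# ∷ w) (leadRatio v g ∷ []) , addP v (negP (scale (leadRatio v g) g))
    where
    w v : P
    w = proj₁ (divMod h g)
    v = c ∷ proj₂ (divMod h g)

  _div_ _mod_ : P → P → P
  h div g = proj₁ (divMod h g)
  h mod g = proj₂ (divMod h g)

  [x+y]+[z-y]≈x+z : ∀ x y z → addP (addP x y) (addP z (negP y)) ≋ addP x z
  [x+y]+[z-y]≈x+z x y z = begin
    addP (addP x y) (addP z (negP y))  ≈⟨ addP-assoc x y _ ⟩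
    addP x (addP y (addP z (negP y)))  ≈⟨ addP-congˡ x (≋-sym (addP-assoc y z (negP y))) ⟩
    addP x (addP (addP y z) (negP y))  ≈⟨ addP-congˡ x (xyx⁻¹≈y y z) ⟩
    addP x z                           ∎
    where open SetoidReasoning ≋-setoid

  div-mod-≋ : ∀ h g → h ≋ addP (mulP (h div g) g) (h mod g)
  div-mod-≋ []      g = ≋-refl
  div-mod-≋ (c ∷ h) g = begin
    c ∷ h                                                ≈⟨ ∷-cong refl (div-mod-≋ h g) ⟩
    c ∷ addP (mulP w g) u                                ≈⟨ ∷-cong (sym (+-identityˡ c)) ≋-refl ⟩
    addP (0# ∷ mulP w g) v                               ≈⟨ addP-congʳ v (≋-sym (mulP-0∷ w g)) ⟩
    addP (mulP (0# ∷ w) g) v                             ≈⟨ [x+y]+[z-y]≈x+z (mulP (0# ∷ w) g) (mulP (t ∷ []) g) v ⟨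
    addP (addP (mulP (0# ∷ w) g) (mulP (t ∷ []) g)) (addP v (negP (mulP (t ∷ []) g)))
      ≈⟨ addP-cong (≋-sym (mulP-distribʳ g (0# ∷ w) (t ∷ []))) (addP-congˡ v (negP-cong (mulP-singleton t g))) ⟩
    addP (mulP (addP (0# ∷ w) (t ∷ [])) g) (addP v (negP (scale t g))) ∎
    where
    open SetoidReasoning ≋-setoid
    w u v : P
    w = h div g
    u = h mod g
    v = c ∷ u
    t : Carrier
    t = leadRatio v g

  len-mod≤ : ∀ h g {m} → len g ≡ suc m → len (h mod g) ≤ m
  len-mod≤ []      g lg = z≤n
  len-mod≤ (c ∷ h) g {m} lg = vanishes⇒len≤ (addP v (negP (scale t g))) vanishes
    where
    v : P
    v = c ∷ h mod g
    t : Carrier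
    t = leadRatio v g
    coeff-mod : ∀ i → coeff (addP v (negP (scale t g))) i ≈ coeff v i + - (t * coeff g i)
    coeff-mod i = trans (coeff-addP v (negP (scale t g)) i)
                        (+-congˡ (trans (coeff-negP (scale t g) i) (-‿cong (coeff-scale t g i))))
    vanishes : ∀ i → m ≤ i → coeff (addP v (negP (scale t g))) i ≈ 0#
    vanishes i m≤i with ℕₚ.m≤n⇒m<n∨m≡n m≤i
    ... | inj₂ ≡.refl = trans (coeff-mod m) (trans (+-congˡ (-‿cong (leadRatio-cancels v g lg))) (-‿inverseʳ _))
    ... | inj₁ m<i    = trans (coeff-mod i) (trans (+-cong v-vanishes (-‿cong (trans (*-congˡ g-vanishes) (zeroʳ t))))
                                                   (trans (+-identityˡ _) -0#≈0#))
      where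
      v-vanishes : coeff v i ≈ 0#
      v-vanishes = coeff-≥len v (≤-trans (len-∷-≤ c (h mod g)) (≤-trans (s≤s (len-mod≤ h g lg)) m<i))
      g-vanishes : coeff g i ≈ 0#
      g-vanishes = coeff-≥len g (≤-trans (≤-reflexive lg) m<i)

  ∣∧len<⇒≋[] : ∀ {g u m} → len g ≡ suc m → len u ≤ m → g ∣ u → u ≋ []
  ∣∧len<⇒≋[] {g} {u} {m} lg lu (k , kg≈u) with ≋[]? k
  ... | yes k≈0 = ≋-trans (≋-sym kg≈u) (mulP-congˡ g k≈0)
  ... | no  k≉0 = ⊥-elim (ℕₚ.<-irrefl ≡.refl (begin-strict
    len g          ≤⟨ len≤len-mulPʳ k g k≉0 ⟩
    len (mulP k g) ≡⟨ len-cong kg≈u ⟩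
    len u          ≤⟨ lu ⟩
    m              <⟨ ℕₚ.n<1+n m ⟩
    suc m          ≡⟨ lg ⟨
    len g          ∎))
    where open ℕₚ.≤-Reasoning

  ∣⇒≋div* : ∀ {g f m} → len g ≡ suc m → g ∣ f → f ≋ mulP (f div g) g
  ∣⇒≋div* {g} {f} lg (k , kg≈f) = begin
    f                               ≈⟨ div-mod-≋ f g ⟩
    addP (mulP w g) (f mod g)       ≈⟨ addP-congˡ (mulP w g) (∣∧len<⇒≋[] lg (len-mod≤ f g lg) g∣mod) ⟩
    addP (mulP w g) []              ≈⟨ addP-identityʳ (mulP w g) ⟩
    mulP w g                        ∎
    where
    open SetoidReasoning ≋-setoid
    w : P
    w = f div g
    g∣mod : g ∣ f mod g
    g∣mod = k ℙ.- w , ≋-trans ([y-z]x≈yx-zx g k w) (≋-trans (addP-congʳ (negP (mulP w g)) (≋-trans kg≈f (div-mod-≋ f g)))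
                                                      (xyx⁻¹≈y (mulP w g) (f mod g)))

  ∣-addP : ∀ {e x y} → e ∣ x → e ∣ y → e ∣ addP x y
  ∣-addP {e} (p , pe≈x) (q , qe≈y) = addP p q , ≋-trans (mulP-distribʳ e p q) (addP-cong pe≈x qe≈y)

  Coprime : P → P → Set (c ⊔ ℓ)
  Coprime a b = ∀ {e} → e ∣ a → e ∣ b → len e ≤ 1

  bezout : ∀ a b → ∃₂ λ s t → addP (mulP s a) (mulP t b) ∣ a × addP (mulP s a) (mulP t b) ∣ b
  bezout a b = go (len b) a b ≤-refl
    where
    go : ∀ n a b → len b ≤ n → ∃₂ λ s t → addP (mulP s a) (mulP t b) ∣ a × addP (mulP s a) (mulP t b) ∣ b
    go n a b lb with ≋[]? b
    go n a b lb | yes b≈0 = 1# ∷ [] , [] , ∣ʳ-reflexive d≈a , ∣ʳ-respʳ-≈ (≋-sym b≈0) (_ ∣0)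
      where
      d≈a : addP (mulP (1# ∷ []) a) [] ≋ a
      d≈a = ≋-trans (addP-identityʳ _) (mulP-identityˡ a)
    go zero    a b lb | no b≉0 = ⊥-elim (b≉0 (len≡0⇒≋[] b (n≤0⇒n≡0 lb)))
    go (suc n) a b lb | no b≉0 with ≉[]⇒len≡suc b≉0
    ... | m , lg with go n b (a mod b) (≤-trans (len-mod≤ a b lg) (ℕₚ.≤-pred (≤-trans (≤-reflexive (≡.sym lg)) lb)))
    ...   | s , t , d∣b , d∣u = t , s ℙ.- mulP t (a div b) , ∣ʳ-respˡ-≈ d≈d′ d∣a , ∣ʳ-respˡ-≈ d≈d′ d∣b
      where
      w u : P
      w = a div b
      u = a mod b
      a≈wb+u : a ≋ addP (mulP w b) u
      a≈wb+u = div-mod-≋ a b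
      d∣a : addP (mulP s b) (mulP t u) ∣ a
      d∣a = ∣ʳ-respʳ-≈ (≋-sym a≈wb+u) (∣-addP (x∣ʳy⇒x∣ʳzy w d∣b) d∣u)
      d≈d′ : addP (mulP s b) (mulP t u) ≋ addP (mulP t a) (mulP (s ℙ.- mulP t w) b)
      d≈d′ = begin
        addP (mulP s b) (mulP t u)
          ≈⟨ addP-comm (mulP s b) (mulP t u) ⟩
        addP (mulP t u) (mulP s b)
          ≈⟨ [x+y]+[z-y]≈x+z (mulP t u) (mulP t (mulP w b)) (mulP s b) ⟨
        addP (addP (mulP t u) (mulP t (mulP w b))) (addP (mulP s b) (negP (mulP t (mulP w b))))
          ≈⟨ addP-cong (≋-trans (addP-comm (mulP t u) (mulP t (mulP w b))) (≋-sym (mulP-distribˡ t (mulP w b) u)))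
                       (≋-trans (addP-congˡ (mulP s b) (negP-cong (≋-sym (mulP-assoc t w b))))
                                (≋-sym ([y-z]x≈yx-zx b s (mulP t w)))) ⟩
        addP (mulP t (addP (mulP w b) u)) (mulP (s ℙ.- mulP t w) b)
          ≈⟨ addP-congʳ (mulP (s ℙ.- mulP t w) b) (mulP-congʳ t a≈wb+u) ⟨
        addP (mulP t a) (mulP (s ℙ.- mulP t w) b)
          ∎
        where open SetoidReasoning ≋-setoid

  len≤1⇒≋const : ∀ f → len f ≤ 1 → f ≋ coeff f 0 ∷ []
  len≤1⇒≋const f lf = mk≋ λ { zero → refl ; (suc i) → coeff-≥len f (≤-trans lf (s≤s z≤n)) }

  len≤1⇒unit : ∀ d → len d ≤ 1 → ¬ d ≋ [] → mulP (inv (coeff d 0) ∷ []) d ≋ 1# ∷ []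
  len≤1⇒unit d ld d≉0 = begin
    mulP (inv δ ∷ []) d     ≈⟨ mulP-singleton (inv δ) d ⟩
    scale (inv δ) d         ≈⟨ scale-cong refl (len≤1⇒≋const d ld) ⟩
    inv δ * δ ∷ []          ≈⟨ ∷-cong (trans (*-comm _ _) (*-inverseʳ δ≉0)) ≋-refl ⟩
    1# ∷ []                 ∎
    where
    open SetoidReasoning ≋-setoid
    δ : Carrier
    δ = coeff d 0
    δ≉0 : ¬ δ ≈ 0#
    δ≉0 δ≈0 = d≉0 (≋-trans (len≤1⇒≋const d ld) (∷-≋[] δ≈0 (≋-refl {[]})))

  coprime-divisor : ∀ {g u h} → ¬ g ≋ [] → Coprime g u → g ∣ mulP u h → g ∣ h
  coprime-divisor {g} {u} {h} g≉0 g⊥u g∣uh with bezout g u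
  ... | s , t , d∣g , d∣u =
    ∣ʳ-respʳ-≈ combination≈h (∣-addP (x∣ʳyx g (mulP (mulP e s) h)) (x∣ʳy⇒x∣ʳzy (mulP e t) g∣uh))
    where
    open SetoidReasoning ≋-setoid
    open ℙ-Solver using (solve; _:+_; _:*_; _:=_)
    d e : P
    d = addP (mulP s g) (mulP t u)
    e = inv (coeff d 0) ∷ []
    combination≈h : addP (mulP (mulP (mulP e s) h) g) (mulP (mulP e t) (mulP u h)) ≋ h
    combination≈h = begin
      addP (mulP (mulP (mulP e s) h) g) (mulP (mulP e t) (mulP u h))
        ≈⟨ solve 6 (λ e s h g t u → e :* s :* h :* g :+ e :* t :* (u :* h) := e :* (s :* g :+ t :* u) :* h)
                 ≋-refl e s h g t u ⟩
      mulP (mulP e d) h       ≈⟨ mulP-congˡ h (len≤1⇒unit d (g⊥u d∣g d∣u) (x∣y∧y≉0⇒x≉0 d∣g g≉0)) ⟩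
      mulP (1# ∷ []) h        ≈⟨ mulP-identityˡ h ⟩
      h                       ∎

  Monic : ℕ → P → Set ℓ
  Monic d g = len g ≡ suc d × coeff g d ≈ 1#

  monic≉[] : ∀ {d} g → Monic d g → ¬ g ≋ []
  monic≉[] g (lg , _) = len≡suc⇒≉[] lg

  len-mulP-factor : ∀ k g {d n} → ¬ k ≋ [] → len g ≡ suc d → len (mulP k g) ≡ suc n →
                    ∃ λ y → len k ≡ suc y × d ℕ.+ y ≡ n
  len-mulP-factor k g {d} {n} k≉0 lg lkg with ≉[]⇒len≡suc k≉0
  ... | y , lk = y , lk , ℕₚ.suc-injective
    (≡.trans (≡.cong suc (ℕₚ.+-comm d y)) (≡.trans (≡.sym (len-mulP k g lk lg)) lkg))

  monic-∣-antisym : ∀ {d d′ g g′} → Monic d g → Monic d′ g′ → g ∣ g′ → g′ ∣ g → g ≋ g′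
  monic-∣-antisym {d} {d′} {g} {g′} g-monic@(lg , g-lead) g′-monic@(lg′ , g′-lead) (k , kg≈g′) g′∣g =
    ≋-trans (≋-sym (mulP-identityˡ g)) (≋-trans (mulP-congˡ g (∷-cong (sym κ≈1) (≋-refl {[]})))
      (≋-trans (mulP-congˡ g (≋-sym (len≤1⇒≋const k lk))) kg≈g′))
    where
    d≡d′ : d ≡ d′
    d≡d′ = ℕₚ.suc-injective (≡.trans (≡.sym lg) (≡.trans
             (≤-antisym (∣⇒len≤ (k , kg≈g′) (monic≉[] g′ g′-monic)) (∣⇒len≤ g′∣g (monic≉[] g g-monic))) lg′))
    k≉0 : ¬ k ≋ []
    k≉0 k≈0 = monic≉[] g′ g′-monic (≋-trans (≋-sym kg≈g′) (mulP-congˡ g k≈0))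
    lk : len k ≤ 1
    lk with len-mulP-factor k g k≉0 lg (≡.trans (len-cong kg≈g′) (≡.trans lg′ (≡.cong suc (≡.sym d≡d′))))
    ... | y , ly , d+y≡d =
      ≤-reflexive (≡.trans ly (≡.cong suc (ℕₚ.+-cancelˡ-≡ d y 0 (≡.trans d+y≡d (≡.sym (ℕₚ.+-identityʳ d))))))
    κ : Carrier
    κ = coeff k 0
    κ≈1 : κ ≈ 1#
    κ≈1 = begin
      κ                      ≈⟨ *-identityʳ κ ⟨
      κ * 1#                 ≈⟨ *-congˡ g-lead ⟨
      κ * coeff g d          ≈⟨ coeff-mulP-top k g lk (≤-reflexive lg) ⟨
      coeff (mulP k g) d     ≈⟨ coeff≈ kg≈g′ d ⟩
      coeff g′ d             ≡⟨ ≡.cong (coeff g′) d≡d′ ⟩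
      coeff g′ d′            ≈⟨ g′-lead ⟩
      1#                     ∎
      where open SetoidReasoning setoid

  -- The injection

  len-div≤ : ∀ h g {m k} → len g ≡ suc m → len h ≤ m ℕ.+ k → len (h div g) ≤ k
  len-div≤ h g {m} {k} lg lh with ≋[]? (h div g)
  ... | yes w≈0 = ≤-trans (≤-reflexive (len-cong w≈0)) z≤n
  ... | no  w≉0 with ≉[]⇒len≡suc w≉0
  ...   | b , lw =
    ≤-trans (≤-reflexive lw) (ℕₚ.+-cancelˡ-≤ m (suc b) k (≤-trans (≤-reflexive (ℕₚ.+-suc m b)) (≤-trans top<len lh)))
    where
    w u : P
    w = h div g
    u = h mod g
    top≉0 : ¬ coeff h (b ℕ.+ m) ≈ 0#
    top≉0 top≈0 = x≉0∧y≉0⇒xy≉0 (coeff-lead w lw) (coeff-lead g lg) (begin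
      coeff w b * coeff g m                        ≈⟨ coeff-mulP-top w g (≤-reflexive lw) (≤-reflexive lg) ⟨
      coeff (mulP w g) (b ℕ.+ m)                   ≈⟨ +-identityʳ _ ⟨
      coeff (mulP w g) (b ℕ.+ m) + 0#
        ≈⟨ +-congˡ (coeff-≥len u (≤-trans (len-mod≤ h g lg) (ℕₚ.m≤n+m m b))) ⟨
      coeff (mulP w g) (b ℕ.+ m) + coeff u (b ℕ.+ m) ≈⟨ coeff-addP (mulP w g) u (b ℕ.+ m) ⟨
      coeff (addP (mulP w g) u) (b ℕ.+ m)          ≈⟨ coeff≈ (div-mod-≋ h g) (b ℕ.+ m) ⟨
      coeff h (b ℕ.+ m)                            ≈⟨ top≈0 ⟩
      0#                                           ∎)
      where open SetoidReasoning setoid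
    top<len : suc (m ℕ.+ b) ≤ len h
    top<len = ≤-trans (≤-reflexive (≡.cong suc (ℕₚ.+-comm m b))) (coeff≉0⇒<len h top≉0)

  len-++-≤ : ∀ r w → len (r ++ w) ≤ length r ℕ.+ len w
  len-++-≤ []      w = ≤-refl
  len-++-≤ (a ∷ r) w = ≤-trans (len-∷-≤ a (r ++ w)) (s≤s (len-++-≤ r w))

  ++-injective : ∀ r r′ {w w′} → length r ≡ length r′ → r ++ w ≋ r′ ++ w′ → r ≋ r′ × w ≋ w′
  ++-injective []      []       _  e = ≋-refl , e
  ++-injective (a ∷ r) (b ∷ r′) eq e with ++-injective r r′ (ℕₚ.suc-injective eq) (∷-injectiveʳ e)
  ... | r≋r′ , w≋w′ = ∷-cong (∷-injectiveˡ e) r≋r′ , w≋w′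

  coprime-mod : ∀ {f h g} → g ∣ f → Coprime f h → Coprime g (h mod g)
  coprime-mod {f} {h} {g} g∣f f⊥h e∣g e∣u =
    f⊥h (∣ʳ-trans e∣g g∣f) (∣ʳ-respʳ-≈ (≋-sym (div-mod-≋ h g)) (∣-addP (x∣ʳy⇒x∣ʳzy (h div g) e∣g) e∣u))

  divisor-unique : ∀ {f d d′ g g′ k k′ u u′} → ¬ f ≋ [] → Monic d g → Monic d′ g′ →
                   Coprime g u → Coprime g′ u′ → f ≋ mulP k g → f ≋ mulP k′ g′ →
                   mulP u k ≋ mulP u′ k′ → g ≋ g′
  divisor-unique {f} {d} {d′} {g} {g′} {k} {k′} {u} {u′}
                 f≉0 g-monic g′-monic g⊥u g′⊥u′ f≈kg f≈k′g′ uk≈u′k′ =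
    monic-∣-antisym g-monic g′-monic
      (coprime-divisor (monic≉[] g g-monic) g⊥u (∣ʳ-respʳ-≈ (≋-sym ug′≈u′g) (x∣ʳyx g u′)))
      (coprime-divisor (monic≉[] g′ g′-monic) g′⊥u′ (∣ʳ-respʳ-≈ ug′≈u′g (x∣ʳyx g′ u)))
    where
    open ℙ-Solver using (solve; _:*_; _:=_)
    ug′≈u′g : mulP u g′ ≋ mulP u′ g
    ug′≈u′g = mulP-cancelˡ f≉0 (begin
      mulP f (mulP u g′)                ≈⟨ mulP-congˡ (mulP u g′) f≈kg ⟩
      mulP (mulP k g) (mulP u g′)
        ≈⟨ solve 4 (λ k g u g′ → k :* g :* (u :* g′) := g :* g′ :* (u :* k)) ≋-refl k g u g′ ⟩
      mulP (mulP g g′) (mulP u k)       ≈⟨ mulP-congʳ (mulP g g′) uk≈u′k′ ⟩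
      mulP (mulP g g′) (mulP u′ k′)
        ≈⟨ solve 4 (λ g g′ u′ k′ → g :* g′ :* (u′ :* k′) := k′ :* g′ :* (u′ :* g)) ≋-refl g g′ u′ k′ ⟩
      mulP (mulP k′ g′) (mulP u′ g)     ≈⟨ mulP-congˡ (mulP u′ g) f≈k′g′ ⟨
      mulP f (mulP u′ g)                ∎)
      where open SetoidReasoning ≋-setoid

  cofactor-len : ∀ {f n d g} → len f ≡ suc n → Monic d g → g ∣ f →
                 ∃ λ y → len (f div g) ≡ suc y × d ℕ.+ y ≡ n
  cofactor-len {f} {n} {d} {g} lf (lg , _) g∣f =
    len-mulP-factor (f div g) g k≉0 lg (≡.trans (≡.sym (len-cong f≈kg)) lf)
    where
    f≈kg : f ≋ mulP (f div g) g
    f≈kg = ∣⇒≋div* lg g∣f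
    k≉0 : ¬ f div g ≋ []
    k≉0 k≈0 = len≡suc⇒≉[] lf (≋-trans f≈kg (mulP-congˡ g k≈0))

  Tuple : Setoid c ℓ
  Tuple = ≋-setoid ×ₛ (≡.setoid ℕ ×ₛ (≋-setoid ×ₛ ≋-setoid))

  Code : Setoid c ℓ
  Code = ≋-setoid ×ₛ ≋-setoid

  Admissible : ℕ → P → P × ℕ × P × P → Set (c ⊔ ℓ)
  Admissible n f (h , d , g , r) = len h ≤ n × Coprime f h × Monic d g × g ∣ f × length r ≡ d

  encode : P → P × ℕ × P × P → P × P
  encode f (h , d , g , r) = mulP (h mod g) (f div g) , r ++ h div g

  encode-bounded : ∀ f {n} x → len f ≡ suc n → Admissible n f x →
                   len (proj₁ (encode f x)) ≤ n × len (proj₂ (encode f x)) ≤ n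
  encode-bounded f {n} (h , d , g , r) lf (lh , _ , g-monic , g∣f , lr) = bounds (cofactor-len lf g-monic g∣f)
    where
    lg : len g ≡ suc d
    lg = proj₁ g-monic
    bounds : (∃ λ y → len (f div g) ≡ suc y × d ℕ.+ y ≡ n) →
             len (mulP (h mod g) (f div g)) ≤ n × len (r ++ h div g) ≤ n
    bounds (y , lk , d+y≡n) =
        ≤-trans (len-mulP-≤ (h mod g) (f div g) (len-mod≤ h g lg) (≤-reflexive lk)) (≤-reflexive d+y≡n)
      , ≤-trans (len-++-≤ r (h div g))
          (≤-trans (≤-reflexive (≡.cong (ℕ._+ len (h div g)) lr))
            (≤-trans (ℕₚ.+-monoʳ-≤ d (len-div≤ h g lg (≤-trans lh (≤-reflexive (≡.sym d+y≡n)))))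
              (≤-reflexive d+y≡n)))

  encode-injective : ∀ f {n} x y → len f ≡ suc n → Admissible n f x → Admissible n f y →
                     Setoid._≈_ Code (encode f x) (encode f y) → Setoid._≈_ Tuple x y
  encode-injective f (h , d , g , r) (h′ , d′ , g′ , r′) lf
    (_ , f⊥h , g-monic@(lg , _) , g∣f , lr) (_ , f⊥h′ , g′-monic@(lg′ , _) , g′∣f , lr′)
    (uk≈u′k′ , rw≈r′w′) =
    h≈h′ , d≡d′ , g≈g′ , proj₁ r≈r′×w≈w′
    where
    open SetoidReasoning ≋-setoid
    k k′ w w′ : P
    k = f div g
    k′ = f div g′
    w = h div g
    w′ = h′ div g′
    f≉0 : ¬ f ≋ []
    f≉0 = len≡suc⇒≉[] lf
    f≈kg : f ≋ mulP k g
    f≈kg = ∣⇒≋div* lg g∣f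
    f≈k′g′ : f ≋ mulP k′ g′
    f≈k′g′ = ∣⇒≋div* lg′ g′∣f
    g≈g′ : g ≋ g′
    g≈g′ = divisor-unique f≉0 g-monic g′-monic (coprime-mod g∣f f⊥h) (coprime-mod g′∣f f⊥h′)
             f≈kg f≈k′g′ uk≈u′k′
    d≡d′ : d ≡ d′
    d≡d′ = ℕₚ.suc-injective (≡.trans (≡.sym lg) (≡.trans (len-cong g≈g′) lg′))
    k≈k′ : k ≋ k′
    k≈k′ = mulP-cancelʳ (monic≉[] g g-monic)
             (≋-trans (≋-sym f≈kg) (≋-trans f≈k′g′ (mulP-congʳ k′ (≋-sym g≈g′))))
    k≉0 : ¬ k ≋ []
    k≉0 k≈0 = f≉0 (≋-trans f≈kg (mulP-congˡ g k≈0))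
    u≈u′ : h mod g ≋ h′ mod g′
    u≈u′ = mulP-cancelʳ k≉0 (≋-trans uk≈u′k′ (mulP-congʳ (h′ mod g′) (≋-sym k≈k′)))
    r≈r′×w≈w′ : r ≋ r′ × w ≋ w′
    r≈r′×w≈w′ = ++-injective r r′ (≡.trans lr (≡.trans d≡d′ (≡.sym lr′))) rw≈r′w′
    h≈h′ : h ≋ h′
    h≈h′ = begin
      h                                ≈⟨ div-mod-≋ h g ⟩
      addP (mulP w g) (h mod g)        ≈⟨ addP-cong (ℙ.*-cong (proj₂ r≈r′×w≈w′) g≈g′) u≈u′ ⟩
      addP (mulP w′ g′) (h′ mod g′)    ≈⟨ div-mod-≋ h′ g′ ⟨
      h′                               ∎

  -- Enumerations

  isZeroP⇒≋[] : ∀ p → T (isZeroP p) → p ≋ []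
  isZeroP⇒≋[] []      _ = ≋-refl
  isZeroP⇒≋[] (a ∷ p) t with a ≟ 0#
  ... | yes a≈0 = ∷-≋[] a≈0 (isZeroP⇒≋[] p t)

  ≋[]⇒isZeroP : ∀ p → p ≋ [] → T (isZeroP p)
  ≋[]⇒isZeroP []      _    = tt
  ≋[]⇒isZeroP (a ∷ p) p≈0 with a ≟ 0#
  ... | yes _   = ≋[]⇒isZeroP p (mk≋ λ i → coeff≈ p≈0 (suc i))
  ... | no  a≉0 = a≉0 (coeff≈ p≈0 0)

  eqP⇒≋ : ∀ f g → T (eqP f g) → f ≋ g
  eqP⇒≋ f g t = x∙y⁻¹≈ε⇒x≈y f g (isZeroP⇒≋[] (f ℙ.- g) t)

  ≋⇒eqP : ∀ f g → f ≋ g → T (eqP f g)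
  ≋⇒eqP f g f≈g = ≋[]⇒isZeroP (f ℙ.- g) (x≈y⇒x∙y⁻¹≈ε f≈g)

  allVecs-length : ∀ n {v} → v ∈ allVecs n → length v ≡ n
  allVecs-length zero    (here ≡.refl) = ≡.refl
  allVecs-length (suc n) v∈
    with _ , v∈map ← Any.satisfied (∈-concatMap⁻ (λ a → map (a ∷_) (allVecs n)) {xs = elems} v∈)
    with _ , v′∈ , ≡.refl ← ∈-map⁻ _ v∈map = ≡.cong suc (allVecs-length n v′∈)

  length-allVecs : ∀ n → length (allVecs n) ≡ q ^ n
  length-allVecs zero    = ≡.refl
  length-allVecs (suc n) = begin
    length (concatMap (λ a → map (a ∷_) (allVecs n)) elems)
      ≡⟨ length-concatMap (λ a → map (a ∷_) (allVecs n)) elems ⟩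
    sum (map (λ a → length (map (a ∷_) (allVecs n))) elems)
      ≡⟨ ≡.cong sum (map-cong (λ a → ≡.trans (length-map (a ∷_) (allVecs n)) (length-allVecs n)) elems) ⟩
    sum (map (λ _ → q ^ n) elems)                             ≡⟨ sum-map-const (q ^ n) elems ⟩
    q ℕ.* q ^ n                                               ∎
    where open ≡.≡-Reasoning

  allVecs-∷⁺ : ∀ n a {p w} → Any (λ v → p ≋ v ++ w) (allVecs n) → Any (λ v → a ∷ p ≋ v ++ w) (allVecs (suc n))
  allVecs-∷⁺ n a p∈ = Anyₚ.concatMap⁺ (λ a → map (a ∷_) (allVecs n))
    (Any.map (λ a≈x → Anyₚ.map⁺ (Any.map (∷-cong a≈x) p∈)) (complete a))

  allVecs-++-complete : ∀ n p w → (∀ i → coeff p (n ℕ.+ i) ≈ coeff w i) → Any (λ v → p ≋ v ++ w) (allVecs n)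
  allVecs-++-complete zero    p       w agree = here (mk≋ agree)
  allVecs-++-complete (suc n) []      w agree =
    Any.map (≋-trans (≋-sym (∷-≋[] refl (≋-refl {[]})))) (allVecs-∷⁺ n 0# (allVecs-++-complete n [] w agree))
  allVecs-++-complete (suc n) (a ∷ p) w agree = allVecs-∷⁺ n a (allVecs-++-complete n p w agree)

  allVecs-complete : ∀ n p → len p ≤ n → Any (p ≋_) (allVecs n)
  allVecs-complete n p lp = Any.map (λ {v} p≈v++[] → ≋-trans p≈v++[] (≋-reflexive (++-identityʳ v)))
    (allVecs-++-complete n p [] λ i → coeff-≥len p (≤-trans lp (ℕₚ.m≤m+n n i)))

  allVecs-unique : ∀ n → Unique ≋-setoid (allVecs n)
  allVecs-unique zero    = All.[] ∷ []
  allVecs-unique (suc n) = Uniqueₚ.concat⁺ ≋-setoid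
    (Allₚ.map⁺ (All.universal (λ a → Uniqueₚ.map⁺ ≋-setoid ≋-setoid ∷-injectiveʳ (allVecs-unique n)) elems))
    (AllPairsₚ.map⁺ (AllPairs.map disjoint distinct))
    where
    disjoint : ∀ {a b} → ¬ a ≈ b → Disjoint ≋-setoid (map (a ∷_) (allVecs n)) (map (b ∷_) (allVecs n))
    disjoint a≉b (v∈a , v∈b)
      with _ , _ , v≈a∷x ← SetoidMembershipₚ.∈-map⁻ ≋-setoid ≋-setoid v∈a
         | _ , _ , v≈b∷y ← SetoidMembershipₚ.∈-map⁻ ≋-setoid ≋-setoid v∈b
      = a≉b (∷-injectiveˡ (≋-trans (≋-sym v≈a∷x) v≈b∷y))

  isZeroC-complete : ∀ {a} → a ≈ 0# → T (isZeroC a)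
  isZeroC-complete {a} a≈0 with a ≟ 0#
  ... | yes _   = tt
  ... | no  a≉0 = a≉0 a≈0

  1≉0 : ¬ 1# ≈ 0#
  1≉0 1≈0 = 0≉1 (sym 1≈0)

  len-snoc : ∀ v {a} → ¬ a ≈ 0# → len (v ++ [ a ]) ≡ suc (length v)
  len-snoc []      {a} a≉0 with a ≟ 0#
  ... | yes a≈0 = ⊥-elim (a≉0 a≈0)
  ... | no  _   = ≡.refl
  len-snoc (b ∷ v) a≉0 rewrite len-snoc v a≉0 = ≡.refl

  coeff-snoc : ∀ v a → coeff (v ++ [ a ]) (length v) ≡ a
  coeff-snoc []      a = ≡.refl
  coeff-snoc (b ∷ v) a = coeff-snoc v a

  monicDeg-monic : ∀ d {g} → g ∈ monicDeg d → Monic d g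
  monicDeg-monic d g∈ with v , v∈ , ≡.refl ← ∈-map⁻ (_++ [ 1# ]) g∈ =
      ≡.trans (len-snoc v 1≉0) (≡.cong suc (allVecs-length d v∈))
    , ≡.subst (λ i → coeff (v ++ [ 1# ]) i ≈ 1#) (allVecs-length d v∈) (reflexive (coeff-snoc v 1#))

  monicDeg-unique : ∀ d → Unique ≋-setoid (monicDeg d)
  monicDeg-unique d = Uniqueₚ.map⁺ ≋-setoid ≋-setoid snoc-injective (allVecs-unique d)
    where
    snoc-injective : ∀ {v w} → v ++ [ 1# ] ≋ w ++ [ 1# ] → v ≋ w
    snoc-injective {v} {w} e = proj₁ (++-injective v w
      (ℕₚ.suc-injective (≡.trans (≡.sym (len-snoc v 1≉0)) (≡.trans (len-cong e) (len-snoc w 1≉0)))) e)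

  polysDeg-len : ∀ n {f} → f ∈ polysDeg n → len f ≡ suc n
  polysDeg-len n f∈
    with a , f∈a ← Any.satisfied (∈-concatMap⁻ (λ a → if isZeroC a then [] else map (_++ [ a ]) (allVecs n)) {xs = elems} f∈)
    with a ≟ 0# | f∈a
  ... | no a≉0 | f∈a′ with v , v∈ , ≡.refl ← ∈-map⁻ (_++ [ a ]) f∈a′ =
    ≡.trans (len-snoc v a≉0) (≡.cong suc (allVecs-length n v∈))

  polysDeg-complete : ∀ n f → len f ≡ suc n → Any (f ≋_) (polysDeg n)
  polysDeg-complete n f lf = Anyₚ.concatMap⁺ (λ a → if isZeroC a then [] else map (_++ [ a ]) (allVecs n))
      (Any.map top∈ (complete (coeff f n)))
    where
    top∈ : ∀ {a} → coeff f n ≈ a → Any (f ≋_) (if isZeroC a then [] else map (_++ [ a ]) (allVecs n))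
    top∈ {a} fn≈a with a ≟ 0#
    ... | yes a≈0 = ⊥-elim (coeff-lead f lf (trans fn≈a a≈0))
    ... | no  _   = Anyₚ.map⁺ (allVecs-++-complete n f [ a ] agree)
      where
      agree : ∀ i → coeff f (n ℕ.+ i) ≈ coeff [ a ] i
      agree zero    = ≡.subst (λ k → coeff f k ≈ a) (≡.sym (ℕₚ.+-identityʳ n)) fn≈a
      agree (suc i) = coeff-≥len f
        (≤-trans (≤-reflexive lf) (≤-trans (s≤s (ℕₚ.m≤m+n n i)) (≤-reflexive (≡.sym (ℕₚ.+-suc n i)))))

  length-polysDeg≤ : ∀ n → length (polysDeg n) ≤ (q ∸ 1) ℕ.* q ^ n
  length-polysDeg≤ n = begin
    length (concatMap G elems)                             ≡⟨ length-concatMap G elems ⟩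
    sum (map (length ∘ G) elems)                           ≡⟨ ≡.cong sum (map-cong length-G elems) ⟩
    sum (map (λ a → if isZeroC a then 0 else q ^ n) elems) ≤⟨ sum-map-if-≤ isZeroC (q ^ n) elems zero∈elems ⟩
    (q ∸ 1) ℕ.* q ^ n                                      ∎
    where
    open ℕₚ.≤-Reasoning
    G : Carrier → List P
    G a = if isZeroC a then [] else map (_++ [ a ]) (allVecs n)
    length-G : ∀ a → length (G a) ≡ (if isZeroC a then 0 else q ^ n)
    length-G a with isZeroC a
    ... | true  = ≡.refl
    ... | false = ≡.trans (length-map (_++ [ a ]) (allVecs n)) (length-allVecs n)
    zero∈elems : Any (T ∘ isZeroC) elems
    zero∈elems = Any.map (λ 0≈a → isZeroC-complete (sym 0≈a)) (complete 0#)

  len≤length : ∀ p → len p ≤ length p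
  len≤length []      = z≤n
  len≤length (a ∷ p) = ≤-trans (len-∷-≤ a p) (s≤s (len≤length p))

  divides-sound : ∀ g f → T (divides g f) → g ∣ f
  divides-sound g f t with k , gk≈f ← Any.satisfied (Anyₚ.any⁻ (λ k → eqP (mulP g k) f) (allVecs (length f)) t) =
    k , ≋-trans (mulP-comm k g) (eqP⇒≋ (mulP g k) f gk≈f)

  ∣⇒bounded-cofactor : ∀ {g f} → g ∣ f → ∃ λ k → mulP g k ≋ f × len k ≤ length f
  ∣⇒bounded-cofactor {g} {f} (k , kg≈f) with ≋[]? f
  ... | yes f≈0 = [] , ≋-trans (mulP-zeroʳ g) (≋-sym f≈0) , z≤n
  ... | no  f≉0 = k , gk≈f , ≤-trans (∣⇒len≤ (g , gk≈f) f≉0) (len≤length f)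
    where
    gk≈f : mulP g k ≋ f
    gk≈f = ≋-trans (mulP-comm g k) kg≈f

  divides-complete : ∀ g f → g ∣ f → T (divides g f)
  divides-complete g f g∣f with k , gk≈f , lk ← ∣⇒bounded-cofactor g∣f =
    Anyₚ.any⁺ (λ k → eqP (mulP g k) f)
      (Any.map (λ {v} k≈v → ≋⇒eqP (mulP g v) f (≋-trans (mulP-congʳ g (≋-sym k≈v)) gk≈f))
               (allVecs-complete (length f) k lk))

  coprime-sound : ∀ {n} f {h} → len f ≡ suc n → T (coprime n f h) → Coprime f h
  coprime-sound {n} f {h} lf t {e} e∣f e∣h with len e in le
  ... | zero        = z≤n
  ... | suc zero    = ≤-refl
  ... | suc (suc j) =
    ⊥-elim (T-not⇒¬T t (Anyₚ.any⁺ _ (Anyₚ.applyUpTo⁺ (λ d → d) (Anyₚ.any⁺ _ common-divisor∈) j<n)))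
    where
    j<n : j < n
    j<n = ℕₚ.≤-pred (≤-trans (≤-reflexive (≡.sym le))
                              (≤-trans (∣⇒len≤ e∣f (len≡suc⇒≉[] lf)) (≤-reflexive lf)))
    common-divisor∈ : Any (λ e′ → T (divides e′ f ∧ divides e′ h)) (polysDeg (suc j))
    common-divisor∈ = Any.map
      (λ e≈e′ → Equivalence.from T-∧ ( divides-complete _ f (∣ʳ-respˡ-≈ e≈e′ e∣f)
                                     , divides-complete _ h (∣ʳ-respˡ-≈ e≈e′ e∣h)))
      (polysDeg-complete (suc j) e le)

  -- Counting

  isResidue : ℕ → P → P → Bool
  isResidue n f h = not (isZeroP h) ∧ coprime n f h

  residues : ℕ → P → List P
  residues n f = filterᵇ (isResidue n f) (allVecs n)

  divisorVectors : P → ℕ → P → List P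
  divisorVectors f d g = if divides g f then allVecs d else []

  ∈-divisorVectors⁻ : ∀ f d g {r} → r ∈ divisorVectors f d g → T (divides g f) × r ∈ allVecs d
  ∈-divisorVectors⁻ f d g r∈ with divides g f
  ... | true = tt , r∈

  divisorTuples : ℕ → P → List (ℕ × P × P)
  divisorTuples n f = dependentProduct (upTo (suc n)) λ d → dependentProduct (monicDeg d) (divisorVectors f d)

  tuples : ℕ → P → List (P × ℕ × P × P)
  tuples n f = cartesianProduct (residues n f) (divisorTuples n f)

  length-divisorTuples : ∀ n f → length (divisorTuples n f) ≡ D1 n f
  length-divisorTuples n f =
    ≡.trans (length-dependentProduct (upTo (suc n)) λ d → dependentProduct (monicDeg d) (divisorVectors f d))
      (≡.cong sum (map-cong (λ d → ≡.trans (length-dependentProduct (monicDeg d) (divisorVectors f d))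
                                      (≡.cong sum (map-cong (length-if d) (monicDeg d)))) (upTo (suc n))))
    where
    length-if : ∀ d g → length (divisorVectors f d g) ≡ (if divides g f then q ^ d else 0)
    length-if d g with divides g f
    ... | true  = length-allVecs d
    ... | false = ≡.refl

  tuples-unique : ∀ n f → Unique Tuple (tuples n f)
  tuples-unique n f = Uniqueₚ.cartesianProduct⁺ ≋-setoid (≡.setoid ℕ ×ₛ (≋-setoid ×ₛ ≋-setoid))
    (Uniqueₚ.filter⁺ ≋-setoid _ (allVecs-unique n))
    (dependentProduct⁺ (≡.setoid ℕ) (≋-setoid ×ₛ ≋-setoid) (Unique≡ₚ.upTo⁺ (suc n)) λ d →
      dependentProduct⁺ ≋-setoid ≋-setoid (monicDeg-unique d) (if-unique d))
    where
    if-unique : ∀ d g → Unique ≋-setoid (divisorVectors f d g)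
    if-unique d g with divides g f
    ... | true  = allVecs-unique d
    ... | false = []

  tuples-admissible : ∀ {n} f {x} → len f ≡ suc n → x ∈ tuples n f → Admissible n f x
  tuples-admissible {n} f {h , d , g , r} lf x∈
    with h∈ , dgr∈ ← ∈-cartesianProduct⁻ (residues n f) (divisorTuples n f) x∈
    with h∈allVecs , h-ok ← ∈-filter⁻ (T? ∘ isResidue n f) h∈
    with _ , gr∈ ← ∈-dependentProduct⁻ (upTo (suc n)) (λ d → dependentProduct (monicDeg d) (divisorVectors f d))
                                       dgr∈
    with g∈ , r∈ ← ∈-dependentProduct⁻ (monicDeg d) (divisorVectors f d) gr∈
    with g∣?f , r∈allVecs ← ∈-divisorVectors⁻ f d g r∈ =
      ≤-trans (len≤length h) (≤-reflexive (allVecs-length n h∈allVecs))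
    , coprime-sound f lf (proj₂ (Equivalence.to T-∧ h-ok))
    , monicDeg-monic d g∈
    , divides-sound g f g∣?f
    , allVecs-length d r∈allVecs

  phi*D1≤ : ∀ n f → len f ≡ suc n → phi n f ℕ.* D1 n f ≤ q ^ n ℕ.* q ^ n
  phi*D1≤ n f lf = begin
    phi n f ℕ.* D1 n f
      ≡⟨ ≡.cong₂ ℕ._*_ (length-filterᵇ (isResidue n f) (allVecs n)) (length-divisorTuples n f) ⟨
    length (residues n f) ℕ.* length (divisorTuples n f)
      ≡⟨ length-cartesianProduct (residues n f) (divisorTuples n f) ⟨
    length (tuples n f)
      ≤⟨ injective⇒length≤ Tuple Code (encode f) (tuples-unique n f) encode-inj encode∈ ⟩
    length (cartesianProduct (allVecs n) (allVecs n))
      ≡⟨ length-cartesianProduct (allVecs n) (allVecs n) ⟩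
    length (allVecs n) ℕ.* length (allVecs n)
      ≡⟨ ≡.cong₂ ℕ._*_ (length-allVecs n) (length-allVecs n) ⟩
    q ^ n ℕ.* q ^ n
      ∎
    where
    open ℕₚ.≤-Reasoning
    encode-inj : ∀ {x y} → x ∈ tuples n f → y ∈ tuples n f →
                 Setoid._≈_ Code (encode f x) (encode f y) → Setoid._≈_ Tuple x y
    encode-inj {x} {y} x∈ y∈ = encode-injective f x y lf (tuples-admissible f lf x∈) (tuples-admissible f lf y∈)
    encode∈ : ∀ {x} → x ∈ tuples n f →
              SetoidMembership._∈_ Code (encode f x) (cartesianProduct (allVecs n) (allVecs n))
    encode∈ {x} x∈ = SetoidMembershipₚ.∈-cartesianProduct⁺ ≋-setoid ≋-setoid
        (allVecs-complete n (proj₁ (encode f x)) (proj₁ bounded))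
        (allVecs-complete n (proj₂ (encode f x)) (proj₂ bounded))
      where
      bounded : len (proj₁ (encode f x)) ≤ n × len (proj₂ (encode f x)) ≤ n
      bounded = encode-bounded f x lf (tuples-admissible f lf x∈)

open import Data.Nat using (_*_)

-- The bound holds for every n; the hypothesis 1 ≤ n is unused.
lemma2p2 : ∀ {c ℓ} (F : FiniteField c ℓ) (n : ℕ) → 1 ≤ n →
    Poly.sumPhiD1 F n ≤ (Poly.q F ∸ 1) * Poly.q F ^ (3 * n)
lemma2p2 F n _ = begin
  sum (map (λ f → phi n f * D1 n f) (polysDeg n))
    ≤⟨ sum-map-mono (polysDeg n) (λ {f} f∈ → phi*D1≤ F n f (polysDeg-len F n f∈)) ⟩
  sum (map (λ _ → q ^ n * q ^ n) (polysDeg n))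
    ≡⟨ sum-map-const (q ^ n * q ^ n) (polysDeg n) ⟩
  length (polysDeg n) * (q ^ n * q ^ n)
    ≤⟨ ℕₚ.*-monoˡ-≤ (q ^ n * q ^ n) (length-polysDeg≤ F n) ⟩
  (q ∸ 1) * q ^ n * (q ^ n * q ^ n)
    ≡⟨ ℕₚ.*-assoc (q ∸ 1) (q ^ n) (q ^ n * q ^ n) ⟩
  (q ∸ 1) * (q ^ n * (q ^ n * q ^ n))
    ≡⟨ ≡.cong ((q ∸ 1) *_) (^-triple q n) ⟨
  (q ∸ 1) * q ^ (3 * n)
    ∎
  where
  open Poly F
  open ℕₚ.≤-Reasoning
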